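{- Let $\mathcal{R}$ be a deterministic oriented 3-CTRS (DCTRS) over a signature $\mathcal{F}$. If the context-sensitive rewrite system $U_{\mathsf{CS}}(\mathcal{R})$ is $\mu$-terminating on original terms, then $\mathcal{R}$ is quasi-decreasing.
   Context: A DCTRS $\mathcal{R}$ over $\mathcal{F}$ is a set of conditional rules $\ell\to r\Leftarrow s_1\approx t_1,\dots,s_n\approx t_n$ ($n\ge 0$) with terms in $\mathcal{T}(\mathcal{F},\mathcal{V})$ such that $\ell\notin\mathcal{V}$, $\mathcal{V}ar(r)\subseteq\mathcal{V}ar(\ell,s_1,t_1,\dots,s_n,t_n)$, and $\mathcal{V}ar(s_i)\subseteq\mathcal{V}ar(\ell,t_1,\dots,t_{i-1})$ for all $1\le i\le n$. Its rewrite relation is $\to_{\mathcal{R}}=\bigcup_{i\ge0}\to_{\mathcal{R}_i}$ where $\mathcal{R}_0=\varnothing$ and $\mathcal{R}_{i+1}=\{\ell\sigma\to r\sigma \mid (\ell\to r\Leftarrow c)\in\mathcal{R},\ \forall (s\approx t)\in c.\ s\sigma\to_{\mathcal{R}_i}^* t\sigma\}$ (with $\to_{\mathcal{S}}$ the ordinary rewrite relation of a TRS $\mathcal{S}$). Rules with $n=0$ form $\mathcal{R}_{\mathsf{u}}$, rules with $n>0$ form $\mathcal{R}_{\mathsf{c}}$. $\mathcal{R}$ is quasi-decreasing if there is a well-founded order $\succ$ on $\mathcal{T}(\mathcal{F},\mathcal{V})$ such that (i) $\succ=(\succ\cup\vartriangleright)^+$ where $\vartriangleright$ is the proper subterm relation,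 (ii) $\to_{\mathcal{R}}\subseteq\succ$, and (iii) for every rule $\ell\to r\Leftarrow s_1\approx t_1,\dots,s_n\approx t_n$ in $\mathcal{R}$, every substitution $\sigma\colon\mathcal{V}\to\mathcal{T}(\mathcal{F},\mathcal{V})$ and every $0\le i<n$: if $s_j\sigma\to_{\mathcal{R}}^* t_j\sigma$ for all $1\le j\le i$, then $\ell\sigma\succ s_{i+1}\sigma$. Unraveling $U(\mathcal{R})$: for each conditional rule $\rho\colon \ell\to r\Leftarrow s_1\approx t_1,\dots,s_n\approx t_n$ with $n>0$, introduce fresh function symbols $U^\rho_1,\dots,U^\rho_n$ and the $n+1$ unconditional rules $\ell\to U^\rho_1(s_1,\vec{X}(\ell))$, $U^\rho_i(t_i,\vec{X}(\ell),\vec{E}(t_1,\dots,t_{i-1}))\to U^\rho_{i+1}(s_{i+1},\vec{X}(\ell),\vec{E}(t_1,\dots,t_i))$ for $1\le i<n$, and $U^\rho_n(t_n,\vec{X}(\ell),\vec{E}(t_1,\dots,t_{n-1}))\to r$. Here $\vec{X}(\ell)$ is the sequence of variables of $\ell$ and $\vec{E}(t_1,\dots,t_i)$ the sequence of the extra variables $\mathcal{EV}(t_1)\cup\dots\cup\mathcal{EV}(t_i)$, where $\mathcal{EV}(t_k)=\mathcal{V}ar(t_k)\setminus\mathcal{V}ar(\ell,t_1,\dots,t_{k-1})$, each in some arbitrary but fixed order. Then $U(\mathcal{R})=\mathcal{R}_{\mathsf{u}}\cup\bigcup_{\rho\in\mathcal{R}_{\mathsf{c}}}U(\rho)$. The context-sensitive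 unraveling $U_{\mathsf{CS}}(\mathcal{R})$ is the TRS $U(\mathcal{R})$ together with the replacement map $\mu$ with $\mu(f)=\{1,\dots,k\}$ for $f\in\mathcal{F}$ of arity $k$ and $\mu(f)=\{1\}$ for the new $U$-symbols; its rewrite relation $\to_\mu$ permits rewriting only at active positions (a position $p$ is active in $t$ if $p=\epsilon$, or $p=iq$, $t=f(t_1,\dots,t_n)$, $i\in\mu(f)$ and $q$ active in $t_i$). $U_{\mathsf{CS}}(\mathcal{R})$ is $\mu$-terminating on original terms if there is no infinite $\to_\mu$-reduction starting from a term in $\mathcal{T}(\mathcal{F},\mathcal{V})$. -}

module Defs where

open import Data.Nat using (ℕ; zero; suc; _<_)
open import Data.Nat.Properties using (_≟_)
open import Data.Fin using (Fin; toℕ) renaming (zero to fzero)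
open import Data.Vec using (Vec; []; _∷_; lookup; _[_]≔_; fromList)
import Data.Vec as Vec
open import Data.List using (List; []; _∷_; _++_; length; take; deduplicate; filter; map)
open import Data.List.Membership.Propositional using (_∈_)
open import Data.List.Membership.DecPropositional _≟_ using (_∉?_)
open import Data.List.Relation.Unary.All using (All)
open import Data.Product using (Σ; _×_; _,_; proj₁; proj₂)
open import Data.Sum using (_⊎_; inj₁; inj₂)
open import Data.Unit using (⊤)
open import Data.Empty using (⊥)
open import Relation.Binary.PropositionalEquality using (_≡_; _≢_)
open import Relation.Binary.Construct.Closure.ReflexiveTransitive using (Star)
open import Relation.Binary.Construct.Closure.Transitive using (TransClosure)
open import Induction.WellFounded using (WellFounded; Acc)

Var : Set
Var = ℕ

module Sig {F : Set} (ar : F → ℕ) where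

  data Term : Set where
    var : Var → Term
    fun : (f : F) → Vec Term (ar f) → Term

  Subst : Set
  Subst = Var → Term

  infixl 30 _⟨_⟩
  mutual
    _⟨_⟩ : Term → Subst → Term
    var x ⟨ σ ⟩ = σ x
    fun f ts ⟨ σ ⟩ = fun f (substV ts σ)

    substV : ∀ {n} → Vec Term n → Subst → Vec Term n
    substV [] σ = []
    substV (t ∷ ts) σ = (t ⟨ σ ⟩) ∷ substV ts σ

  mutual
    vars : Term → List Var
    vars (var x) = x ∷ []
    vars (fun f ts) = varsV ts

    varsV : ∀ {n} → Vec Term n → List Var
    varsV [] = []
    varsV (t ∷ ts) = vars t ++ varsV ts

  data _▷₁_ : Term → Term → Set where
    arg : ∀ f (ts : Vec Term (ar f)) (i : Fin (ar f)) → fun f ts ▷₁ lookup ts i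

  _▷_ : Term → Term → Set
  _▷_ = TransClosure _▷₁_

  -- ordinary rewrite relation →_S of a TRS S (S given as a relation on terms:
  -- S l r means l → r is a rule of S); closed under substitutions and contexts
  data Step (S : Term → Term → Set) : Term → Term → Set where
    root : ∀ {l r} (σ : Subst) → S l r → Step S (l ⟨ σ ⟩) (r ⟨ σ ⟩)
    arg  : ∀ f (ts : Vec Term (ar f)) (i : Fin (ar f)) {t} →
           Step S (lookup ts i) t → Step S (fun f ts) (fun f (ts [ i ]≔ t))

  -- context-sensitive rewrite relation →_μ for replacement map μ
  -- (μ f i means argument position i of f is active)
  data CSStep (μ : (f : F) → Fin (ar f) → Set) (S : Term → Term → Set)
       : Term → Term → Set where
    root : ∀ {l r} (σ : Subst) → S l r → CSStep μ S (l ⟨ σ ⟩) (r ⟨ σ ⟩)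
    arg  : ∀ f (ts : Vec Term (ar f)) (i : Fin (ar f)) {t} → μ f i →
           CSStep μ S (lookup ts i) t → CSStep μ S (fun f ts) (fun f (ts [ i ]≔ t))

  record CRule : Set where
    constructor _⇒_⇐_
    field
      lhs   : Term
      rhs   : Term
      conds : List (Term × Term)
  open CRule public

  condVars : List (Term × Term) → List Var
  condVars [] = []
  condVars ((s , t) ∷ c) = vars s ++ vars t ++ condVars c

  _⊆V_ : List Var → List Var → Set
  xs ⊆V ys = ∀ {x} → x ∈ xs → x ∈ ys

  -- Var(sᵢ) ⊆ Var(ℓ, t₁, …, tᵢ₋₁) for all i (acc = Var(ℓ,t₁,…,tᵢ₋₁))
  DetConds : List Var → List (Term × Term) → Set
  DetConds acc [] = ⊤
  DetConds acc ((s , t) ∷ c) = (vars s ⊆V acc) × DetConds (acc ++ vars t) c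

  IsDRule : CRule → Set
  IsDRule ρ = (∀ x → lhs ρ ≢ var x)
            × (vars (rhs ρ) ⊆V (vars (lhs ρ) ++ condVars (conds ρ)))
            × DetConds (vars (lhs ρ)) (conds ρ)

  module CTRS {I : Set} (rule : I → CRule) where

    Rn : ℕ → Term → Term → Set
    Rn zero l r = ⊥
    Rn (suc n) l r =
      Σ I λ ρ → Σ Subst λ σ →
        (l ≡ lhs (rule ρ) ⟨ σ ⟩) × (r ≡ rhs (rule ρ) ⟨ σ ⟩) ×
        All (λ c → Star (Step (Rn n)) (proj₁ c ⟨ σ ⟩) (proj₂ c ⟨ σ ⟩))
            (conds (rule ρ))

    infix 4 _⟶R_ _⟶R*_
    _⟶R_ : Term → Term → Set
    s ⟶R t = Σ ℕ λ n → Step (Rn n) s t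

    _⟶R*_ : Term → Term → Set
    _⟶R*_ = Star _⟶R_

    IsDCTRS : Set
    IsDCTRS = ∀ ρ → IsDRule (rule ρ)

    QuasiDecreasing : Set₁
    QuasiDecreasing =
      Σ (Term → Term → Set) λ _≻_ →
        WellFounded (λ t s → s ≻ t)
        × (∀ s t → s ≻ t → TransClosure (λ a b → a ≻ b ⊎ a ▷ b) s t)
        × (∀ s t → TransClosure (λ a b → a ≻ b ⊎ a ▷ b) s t → s ≻ t)
        × (∀ s t → s ⟶R t → s ≻ t)
        × (∀ (ρ : I) (σ : Subst) (k : Fin (length (conds (rule ρ)))) →
             (∀ (j : Fin (length (conds (rule ρ)))) → toℕ j < toℕ k →
                proj₁ (lookup (fromList (conds (rule ρ))) j) ⟨ σ ⟩ ⟶R*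
                proj₂ (lookup (fromList (conds (rule ρ))) j) ⟨ σ ⟩) →
             lhs (rule ρ) ⟨ σ ⟩ ≻ proj₁ (lookup (fromList (conds (rule ρ))) k) ⟨ σ ⟩)

module Unravel {F : Set} (ar : F → ℕ) {I : Set} (rule : I → Sig.CRule ar) where
  open Sig ar

  dedup : List Var → List Var
  dedup = deduplicate _≟_

  Xs : I → List Var
  Xs ρ = dedup (vars (lhs (rule ρ)))

  extra : List Var → List Term → List Var
  extra seen [] = []
  extra seen (t ∷ ts) = new ++ extra (seen ++ new) ts
    where new = dedup (filter (_∉? seen) (vars t))

  cs : I → List (Term × Term)
  cs ρ = conds (rule ρ)

  ncs : I → ℕ
  ncs ρ = length (cs ρ)

  Es : I → ℕ → List Var
  Es ρ k = extra (Xs ρ) (map proj₂ (take k (cs ρ)))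

  -- k-th condition (0-based)
  sAt tAt : (ρ : I) → Fin (ncs ρ) → Term
  sAt ρ k = proj₁ (lookup (fromList (cs ρ)) k)
  tAt ρ k = proj₂ (lookup (fromList (cs ρ)) k)

  -- new symbols U^ρ_{k+1}, k : Fin n
  USym : Set
  USym = Σ I λ ρ → Fin (ncs ρ)

  F′ : Set
  F′ = F ⊎ USym

  ar′ : F′ → ℕ
  ar′ (inj₁ f) = ar f
  ar′ (inj₂ (ρ , k)) = suc (length (Xs ρ ++ Es ρ (toℕ k)))

  module T′ = Sig ar′
  open T′ using () renaming (Term to Term′; var to var′; fun to fun′)

  mutual
    emb : Term → Term′
    emb (var x) = var′ x
    emb (fun f ts) = fun′ (inj₁ f) (embV ts)

    embV : ∀ {n} → Vec Term n → Vec Term′ n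
    embV [] = []
    embV (t ∷ ts) = emb t ∷ embV ts

  UT : (ρ : I) (k : Fin (ncs ρ)) → Term′ → Term′
  UT ρ k u = fun′ (inj₂ (ρ , k)) (u ∷ Vec.map var′ (fromList (Xs ρ ++ Es ρ (toℕ k))))

  data UR : Term′ → Term′ → Set where
    uncond : ∀ ρ → cs ρ ≡ [] → UR (emb (lhs (rule ρ))) (emb (rhs (rule ρ)))
    first  : ∀ ρ (k : Fin (ncs ρ)) → toℕ k ≡ 0 →
             UR (emb (lhs (rule ρ))) (UT ρ k (emb (sAt ρ k)))
    middle : ∀ ρ (k k′ : Fin (ncs ρ)) → toℕ k′ ≡ suc (toℕ k) →
             UR (UT ρ k (emb (tAt ρ k))) (UT ρ k′ (emb (sAt ρ k′)))
    last   : ∀ ρ (k : Fin (ncs ρ)) → suc (toℕ k) ≡ ncs ρ →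
             UR (UT ρ k (emb (tAt ρ k))) (emb (rhs (rule ρ)))

  μ : (f : F′) → Fin (ar′ f) → Set
  μ (inj₁ f) i = ⊤
  μ (inj₂ u) i = i ≡ fzero

  infix 4 _⟶μ_
  _⟶μ_ : Term′ → Term′ → Set
  _⟶μ_ = T′.CSStep μ UR

  MuTerminatingOnOriginal : Set
  MuTerminatingOnOriginal = ∀ (t : Term) → Acc (λ b a → a ⟶μ b) (emb t)

-- Take s ≻ t iff emb s (→μ ∪ ⊳μ)⁺ emb t, where ⊳μ steps from a term to an argument at an
-- active position. This is well-founded since a step inside an active subterm is a step of the
-- whole term, so →μ-termination of emb s extends to →μ ∪ ⊳μ; and ≻ contains ▷ because all
-- argument positions of original symbols are active. A rule step ℓσ → rσ of R is simulated by
--   ℓσ →μ U₁(s₁σ, …) →μ* U₁(t₁σ, …) →μ U₂(s₂σ, …) →μ* ⋯ →μ rσ,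
-- where each condition sᵢσ →* tᵢσ is simulated recursively (on the level of R_n) inside the
-- active first argument of Uᵢ. Stopping at U_{i+1}(s_{i+1}σ, …) ⊳μ s_{i+1}σ gives ℓσ ≻ s_{i+1}σ.
module Submission where

open import Defs
open import Level using (Level; 0ℓ)
open import Function using (flip; id; _∘_)
open import Data.Nat using (ℕ; zero; suc; _<_)
open import Data.Nat.Properties using (<-trans; n<1+n)
open import Data.Fin using (Fin; toℕ; fromℕ<) renaming (zero to fzero; suc to fsuc)
open import Data.Fin.Properties using (toℕ<n; toℕ-fromℕ<)
open import Data.Vec using (Vec; []; _∷_; lookup; _[_]≔_; fromList)
open import Data.Vec.Properties using (lookup∘update; []≔-idempotent; []≔-lookup)
open import Data.List using (List; []; _∷_; length)
open import Data.List.Relation.Unary.All as All using (All; _∷_)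
open import Data.Product using (∃; _×_; _,_)
open import Data.Sum using (_⊎_; inj₁; inj₂; [_,_]′)
open import Data.Unit using (tt)
open import Relation.Binary.Core using (Rel; _=[_]⇒_)
open import Relation.Binary.PropositionalEquality
open import Relation.Binary.Construct.Closure.ReflexiveTransitive as Star using (Star; ε; _◅_; _◅◅_; gmap; concat)
open import Relation.Binary.Construct.Closure.Transitive as Plus using (TransClosure; [_]; _∷_; _∷ʳ_; _++_)
open import Induction.WellFounded using (WellFounded; Acc; acc)
import Induction.WellFounded as WF
import Relation.Binary.Construct.On as On

module SubstitutionProperties {F : Set} (ar : F → ℕ) where
  open Sig ar

  infixl 30 _⊚_
  _⊚_ : Subst → Subst → Subst
  (σ ⊚ τ) x = σ x ⟨ τ ⟩

  mutual
    ⟨⟩-⊚ : ∀ t σ τ → t ⟨ σ ⟩ ⟨ τ ⟩ ≡ t ⟨ σ ⊚ τ ⟩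
    ⟨⟩-⊚ (var x) σ τ = refl
    ⟨⟩-⊚ (fun f ts) σ τ = cong (fun f) (substV-⊚ ts σ τ)

    substV-⊚ : ∀ {n} (ts : Vec Term n) σ τ → substV (substV ts σ) τ ≡ substV ts (σ ⊚ τ)
    substV-⊚ [] σ τ = refl
    substV-⊚ (t ∷ ts) σ τ = cong₂ _∷_ (⟨⟩-⊚ t σ τ) (substV-⊚ ts σ τ)

  lookup-substV : ∀ {n} (ts : Vec Term n) i σ → lookup (substV ts σ) i ≡ lookup ts i ⟨ σ ⟩
  lookup-substV (t ∷ ts) fzero σ = refl
  lookup-substV (t ∷ ts) (fsuc i) σ = lookup-substV ts i σ

  substV-[]≔ : ∀ {n} (ts : Vec Term n) i t σ → substV (ts [ i ]≔ t) σ ≡ substV ts σ [ i ]≔ (t ⟨ σ ⟩)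
  substV-[]≔ (u ∷ ts) fzero t σ = refl
  substV-[]≔ (u ∷ ts) (fsuc i) t σ = cong (u ⟨ σ ⟩ ∷_) (substV-[]≔ ts i t σ)

  Step-⟨⟩ : ∀ {S a b} → Step S a b → ∀ σ → Step S (a ⟨ σ ⟩) (b ⟨ σ ⟩)
  Step-⟨⟩ {S} (root {l} {r} τ l→r) σ =
    subst₂ (Step S) (sym (⟨⟩-⊚ l τ σ)) (sym (⟨⟩-⊚ r τ σ)) (root (τ ⊚ σ) l→r)
  Step-⟨⟩ {S} (arg f ts i {t} st) σ =
    subst (λ us → Step S (fun f (substV ts σ)) (fun f us)) (sym (substV-[]≔ ts i t σ))
      (arg f (substV ts σ) i
        (subst (λ u → Step S u (t ⟨ σ ⟩)) (sym (lookup-substV ts i σ)) (Step-⟨⟩ st σ)))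

  Step*-⟨⟩ : ∀ {S a b} → Star (Step S) a b → ∀ σ → Star (Step S) (a ⟨ σ ⟩) (b ⟨ σ ⟩)
  Step*-⟨⟩ ε σ = ε
  Step*-⟨⟩ (st ◅ p) σ = Step-⟨⟩ st σ ◅ Step*-⟨⟩ p σ

module _ {a ℓ : Level} {A : Set a} {R : Rel A ℓ} where

  ⁺⇒* : ∀ {x y} → TransClosure R x y → Star R x y
  ⁺⇒* [ r ] = r ◅ ε
  ⁺⇒* (r ∷ p) = r ◅ ⁺⇒* p

  infixr 5 _*∷ʳ_
  _*∷ʳ_ : ∀ {x y z} → Star R x y → R y z → TransClosure R x z
  ε *∷ʳ r = [ r ]
  (r ◅ p) *∷ʳ r′ = r ∷ (p *∷ʳ r′)

  ⁺-reverse : ∀ {x y} → TransClosure R x y → TransClosure (flip R) y x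
  ⁺-reverse [ r ] = [ r ]
  ⁺-reverse (r ∷ p) = ⁺-reverse p ∷ʳ r

  ⁺-gmap : ∀ {b ℓ′} {B : Set b} {S : Rel B ℓ′} (f : A → B) →
           R =[ f ]⇒ S → TransClosure R =[ f ]⇒ TransClosure S
  ⁺-gmap f R⇒S [ r ] = [ R⇒S r ]
  ⁺-gmap f R⇒S (r ∷ p) = R⇒S r ∷ ⁺-gmap f R⇒S p

module ContextSensitiveRewriting {F : Set} (ar : F → ℕ)
         (μ : (f : F) → Fin (ar f) → Set) (S : Rel (Sig.Term ar) 0ℓ) where
  open Sig ar

  infix 4 _⟶_ _⟶*_ _⟶⁺_ _⊳μ_ _⟶∪⊳μ_
  _⟶_ _⟶*_ _⟶⁺_ : Rel Term 0ℓ
  _⟶_ = CSStep μ S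
  _⟶*_ = Star _⟶_
  _⟶⁺_ = TransClosure _⟶_

  ⟶-under : ∀ {f} (ts : Vec Term (ar f)) {i} → μ f i → ∀ {u t} →
            u ⟶ t → fun f (ts [ i ]≔ u) ⟶ fun f (ts [ i ]≔ t)
  ⟶-under {f} ts {i} active {u} {t} u⟶t =
    subst (λ vs → fun f (ts [ i ]≔ u) ⟶ fun f vs) ([]≔-idempotent ts i)
      (arg f (ts [ i ]≔ u) i active (subst (_⟶ t) (sym (lookup∘update i ts u)) u⟶t))

  ⟶*-arg : ∀ {f} {ts : Vec Term (ar f)} {i} → μ f i → ∀ {t} →
           lookup ts i ⟶* t → fun f ts ⟶* fun f (ts [ i ]≔ t)
  ⟶*-arg {f} {ts} {i} active {t} p =
    subst (λ vs → fun f vs ⟶* fun f (ts [ i ]≔ t)) ([]≔-lookup ts i)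
      (gmap (λ u → fun f (ts [ i ]≔ u)) (⟶-under ts active) p)

  ⟶⁺-arg : ∀ {f} {ts : Vec Term (ar f)} {i} → μ f i → ∀ {t} →
           lookup ts i ⟶⁺ t → fun f ts ⟶⁺ fun f (ts [ i ]≔ t)
  ⟶⁺-arg {f} {ts} {i} active {t} p =
    subst (λ vs → fun f vs ⟶⁺ fun f (ts [ i ]≔ t)) ([]≔-lookup ts i)
      (⁺-gmap (λ u → fun f (ts [ i ]≔ u)) (⟶-under ts active) p)

  data _⊳μ_ : Rel Term 0ℓ where
    active-arg : ∀ f ts i → μ f i → fun f ts ⊳μ lookup ts i

  _⟶∪⊳μ_ : Rel Term 0ℓ
  s ⟶∪⊳μ t = s ⟶ t ⊎ s ⊳μ t

  ⟶-lift-⊳μ* : ∀ {t u u′} → Star _⊳μ_ t u → u ⟶ u′ → ∃ λ t′ → t ⟶ t′ × Star _⊳μ_ t′ u′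
  ⟶-lift-⊳μ* ε u⟶u′ = _ , u⟶u′ , ε
  ⟶-lift-⊳μ* (active-arg f ts i active ◅ p) u⟶u′ with ⟶-lift-⊳μ* p u⟶u′
  ... | v , ti⟶v , q =
    fun f (ts [ i ]≔ v) , arg f ts i active ti⟶v ,
    subst (fun f (ts [ i ]≔ v) ⊳μ_) (lookup∘update i ts v) (active-arg f (ts [ i ]≔ v) i active) ◅ q

  -- Induction on the termination of t, then on its active subterms u: a step of u lifts to a
  -- step of t whose reduct has the reduct of u as an active subterm.
  acc-⟶∪⊳μ : ∀ {t} → Acc (flip _⟶_) t → Acc (flip _⟶∪⊳μ_) t
  acc-⟶∪⊳μ acc-t = below acc-t _ ε
    where
    below : ∀ {t} → Acc (flip _⟶_) t → ∀ u → Star _⊳μ_ t u → Acc (flip _⟶∪⊳μ_) u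
    below {t} (acc rs) = activeSubterm
      where
      reduct : ∀ {u u′} → Star _⊳μ_ t u → u ⟶ u′ → Acc (flip _⟶∪⊳μ_) u′
      reduct p u⟶u′ with ⟶-lift-⊳μ* p u⟶u′
      ... | t′ , t⟶t′ , q = below (rs t⟶t′) _ q

      mutual
        activeSubterm : ∀ u → Star _⊳μ_ t u → Acc (flip _⟶∪⊳μ_) u
        activeSubterm (var x) p = acc λ
          { (inj₁ st) → reduct p st
          ; (inj₂ ()) }
        activeSubterm (fun f ts) p = acc λ
          { (inj₁ st) → reduct p st
          ; (inj₂ (active-arg _ _ i active)) → activeArg ts i (p ◅◅ (active-arg f ts i active ◅ ε)) }

        activeArg : ∀ {n} (ts : Vec Term n) (i : Fin n) →
                    Star _⊳μ_ t (lookup ts i) → Acc (flip _⟶∪⊳μ_) (lookup ts i)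
        activeArg (u ∷ ts) fzero p = activeSubterm u p
        activeArg (u ∷ ts) (fsuc i) p = activeArg ts i p

All-lookup-fromList : ∀ {a p} {A : Set a} {P : A → Set p} {xs : List A} →
                      All P xs → ∀ i → P (lookup (fromList xs) i)
All-lookup-fromList (px ∷ pxs) fzero = px
All-lookup-fromList (px ∷ pxs) (fsuc i) = All-lookup-fromList pxs i

module UnravelingSimulation {F : Set} (ar : F → ℕ) {I : Set} (rule : I → Sig.CRule ar) where
  open Sig ar
  open CTRS rule
  open Unravel ar rule
  open SubstitutionProperties ar
  open ContextSensitiveRewriting ar′ μ UR

  embˢ : Subst → T′.Subst
  embˢ σ x = emb (σ x)

  mutual
    emb-⟨⟩ : ∀ t σ → emb (t ⟨ σ ⟩) ≡ emb t T′.⟨ embˢ σ ⟩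
    emb-⟨⟩ (var x) σ = refl
    emb-⟨⟩ (fun f ts) σ = cong (T′.fun (inj₁ f)) (embV-substV ts σ)

    embV-substV : ∀ {n} (ts : Vec Term n) σ → embV (substV ts σ) ≡ T′.substV (embV ts) (embˢ σ)
    embV-substV [] σ = refl
    embV-substV (t ∷ ts) σ = cong₂ _∷_ (emb-⟨⟩ t σ) (embV-substV ts σ)

  lookup-embV : ∀ {n} (ts : Vec Term n) i → lookup (embV ts) i ≡ emb (lookup ts i)
  lookup-embV (t ∷ ts) fzero = refl
  lookup-embV (t ∷ ts) (fsuc i) = lookup-embV ts i

  embV-[]≔ : ∀ {n} (ts : Vec Term n) i t → embV (ts [ i ]≔ t) ≡ embV ts [ i ]≔ emb t
  embV-[]≔ (u ∷ ts) fzero t = refl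
  embV-[]≔ (u ∷ ts) (fsuc i) t = cong (emb u ∷_) (embV-[]≔ ts i t)

  module RuleSimulation (ρ : I) (σ : Subst) where

    Uσ : Fin (ncs ρ) → Term → T′.Term
    Uσ k u = UT ρ k (emb u) T′.⟨ embˢ σ ⟩

    ConditionsBelow : Fin (ncs ρ) → Set
    ConditionsBelow k = ∀ j → toℕ j < toℕ k → emb (sAt ρ j ⟨ σ ⟩) ⟶* emb (tAt ρ j ⟨ σ ⟩)

    first-step : ∀ k → toℕ k ≡ 0 → emb (lhs (rule ρ) ⟨ σ ⟩) ⟶ Uσ k (sAt ρ k)
    first-step k k≡0 =
      subst (_⟶ Uσ k (sAt ρ k)) (sym (emb-⟨⟩ (lhs (rule ρ)) σ)) (T′.root (embˢ σ) (first ρ k k≡0))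

    condition-steps : ∀ k → emb (sAt ρ k ⟨ σ ⟩) ⟶* emb (tAt ρ k ⟨ σ ⟩) →
                      Uσ k (sAt ρ k) ⟶* Uσ k (tAt ρ k)
    condition-steps k s⟶*t =
      ⟶*-arg refl (subst₂ _⟶*_ (emb-⟨⟩ (sAt ρ k) σ) (emb-⟨⟩ (tAt ρ k) σ) s⟶*t)

    middle-step : ∀ k k′ → toℕ k′ ≡ suc (toℕ k) → Uσ k (tAt ρ k) ⟶ Uσ k′ (sAt ρ k′)
    middle-step k k′ eq = T′.root (embˢ σ) (middle ρ k k′ eq)

    last-step : ∀ k → suc (toℕ k) ≡ ncs ρ → Uσ k (tAt ρ k) ⟶ emb (rhs (rule ρ) ⟨ σ ⟩)
    last-step k eq =
      subst (Uσ k (tAt ρ k) ⟶_) (sym (emb-⟨⟩ (rhs (rule ρ)) σ)) (T′.root (embˢ σ) (last ρ k eq))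

    unconditional-step : cs ρ ≡ [] → emb (lhs (rule ρ) ⟨ σ ⟩) ⟶ emb (rhs (rule ρ) ⟨ σ ⟩)
    unconditional-step eq =
      subst₂ _⟶_ (sym (emb-⟨⟩ (lhs (rule ρ)) σ)) (sym (emb-⟨⟩ (rhs (rule ρ)) σ))
        (T′.root (embˢ σ) (uncond ρ eq))

    reach-condition : ∀ m k → toℕ k ≡ m → ConditionsBelow k →
                      emb (lhs (rule ρ) ⟨ σ ⟩) ⟶* Uσ k (sAt ρ k)
    reach-condition zero k k≡0 _ = first-step k k≡0 ◅ ε
    reach-condition (suc m) k k≡1+m below =
      reach-condition m j j≡m (λ i i<j → below i (<-trans i<j j<k))
        ◅◅ condition-steps j (below j j<k)
        ◅◅ middle-step j k (trans k≡1+m (cong suc (sym j≡m))) ◅ ε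
      where
      m<ncs : m < ncs ρ
      m<ncs = <-trans (n<1+n m) (subst (_< ncs ρ) k≡1+m (toℕ<n k))
      j : Fin (ncs ρ)
      j = fromℕ< m<ncs
      j≡m : toℕ j ≡ m
      j≡m = toℕ-fromℕ< m<ncs
      j<k : toℕ j < toℕ k
      j<k = subst₂ _<_ (sym j≡m) (sym k≡1+m) (n<1+n m)

    rule-simulation : (∀ k → emb (sAt ρ k ⟨ σ ⟩) ⟶* emb (tAt ρ k ⟨ σ ⟩)) →
                      emb (lhs (rule ρ) ⟨ σ ⟩) ⟶⁺ emb (rhs (rule ρ) ⟨ σ ⟩)
    rule-simulation conditions = byConditions (cs ρ) refl
      where
      byConditions : ∀ c → cs ρ ≡ c → emb (lhs (rule ρ) ⟨ σ ⟩) ⟶⁺ emb (rhs (rule ρ) ⟨ σ ⟩)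
      byConditions [] eq = [ unconditional-step eq ]
      byConditions (_ ∷ c) eq =
        (reach-condition _ k refl (λ j _ → conditions j) ◅◅ condition-steps k (conditions k))
          *∷ʳ last-step k (trans (cong suc (toℕ-fromℕ< c<ncs)) (sym ncs≡))
        where
        ncs≡ : ncs ρ ≡ suc (length c)
        ncs≡ = cong length eq
        c<ncs : length c < ncs ρ
        c<ncs = subst (length c <_) (sym ncs≡) (n<1+n (length c))
        k : Fin (ncs ρ)
        k = fromℕ< c<ncs

  open RuleSimulation

  Rn-⟨⟩ : ∀ {n l r} → Rn n l r → ∀ σ → Rn n (l ⟨ σ ⟩) (r ⟨ σ ⟩)
  Rn-⟨⟩ {suc n} (ρ , τ , refl , refl , conditions) σ =
    ρ , τ ⊚ σ , ⟨⟩-⊚ (lhs (rule ρ)) τ σ , ⟨⟩-⊚ (rhs (rule ρ)) τ σ ,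
    All.map (λ {(s , t)} s⟶*t → subst₂ (Star (Step (Rn n))) (⟨⟩-⊚ s τ σ) (⟨⟩-⊚ t τ σ) (Step*-⟨⟩ s⟶*t σ))
            conditions

  mutual
    Rn-simulation : ∀ n {l r} → Rn n l r → emb l ⟶⁺ emb r
    Rn-simulation (suc n) (ρ , σ , refl , refl , conditions) =
      rule-simulation ρ σ (λ k → Step*-simulation n (All-lookup-fromList conditions k))

    Step-simulation : ∀ n {s t} → Step (Rn n) s t → emb s ⟶⁺ emb t
    Step-simulation n (root σ l→r) = Rn-simulation n (Rn-⟨⟩ l→r σ)
    Step-simulation n (arg f ts i {t} st) =
      subst (λ us → T′.fun (inj₁ f) (embV ts) ⟶⁺ T′.fun (inj₁ f) us) (sym (embV-[]≔ ts i t))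
        (⟶⁺-arg tt (subst (_⟶⁺ emb t) (sym (lookup-embV ts i)) (Step-simulation n st)))

    Step*-simulation : ∀ n {s t} → Star (Step (Rn n)) s t → emb s ⟶* emb t
    Step*-simulation n ε = ε
    Step*-simulation n (st ◅ p) = ⁺⇒* (Step-simulation n st) ◅◅ Step*-simulation n p

  ⟶R*-simulation : ∀ {s t} → s ⟶R* t → emb s ⟶* emb t
  ⟶R*-simulation = concat ∘ gmap emb (λ (n , st) → ⁺⇒* (Step-simulation n st))

  infix 4 _≻_
  _≻_ : Rel Term 0ℓ
  s ≻ t = TransClosure _⟶∪⊳μ_ (emb s) (emb t)

  ▷⇒≻ : ∀ {s t} → s ▷ t → s ≻ t
  ▷⇒≻ = ⁺-gmap emb (inj₂ ∘ ▷₁⇒⊳μ)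
    where
    ▷₁⇒⊳μ : ∀ {s t} → s ▷₁ t → emb s ⊳μ emb t
    ▷₁⇒⊳μ (arg f ts i) = subst (_ ⊳μ_) (lookup-embV ts i) (active-arg (inj₁ f) (embV ts) i tt)

  ≻∪▷⁺⇒≻ : ∀ {s t} → TransClosure (λ a b → a ≻ b ⊎ a ▷ b) s t → s ≻ t
  ≻∪▷⁺⇒≻ = Plus.transitive⁻ _≻_ _++_ ∘ ⁺-gmap id [ id , ▷⇒≻ ]′

  ⟶R⇒≻ : ∀ {s t} → s ⟶R t → s ≻ t
  ⟶R⇒≻ (n , st) = ⁺-gmap id inj₁ (Step-simulation n st)

  ≻-wellFounded : MuTerminatingOnOriginal → WellFounded (flip _≻_)
  ≻-wellFounded terminating s =
    On.accessible emb
      (WF.Subrelation.accessible ⁺-reverse (Plus.accessible _ (acc-⟶∪⊳μ (terminating s))))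

  lhs≻condition : ∀ ρ σ k → (∀ j → toℕ j < toℕ k → sAt ρ j ⟨ σ ⟩ ⟶R* tAt ρ j ⟨ σ ⟩) →
                  lhs (rule ρ) ⟨ σ ⟩ ≻ sAt ρ k ⟨ σ ⟩
  lhs≻condition ρ σ k below =
    Star.map inj₁ (reach-condition ρ σ _ k refl (λ j j<k → ⟶R*-simulation (below j j<k)))
      *∷ʳ inj₂ (subst (Uσ ρ σ k (sAt ρ k) ⊳μ_) (sym (emb-⟨⟩ (sAt ρ k) σ))
                  (active-arg (inj₂ (ρ , k)) _ fzero refl))

theorem5 : {F : Set} (ar : F → ℕ) {I : Set} (rule : I → Sig.CRule ar) →
           Sig.CTRS.IsDCTRS ar rule →
           Unravel.MuTerminatingOnOriginal ar rule →
           Sig.CTRS.QuasiDecreasing ar rule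
theorem5 ar rule _ terminating =
  _≻_ , ≻-wellFounded terminating , (λ _ _ s≻t → [ inj₁ s≻t ]) , (λ _ _ → ≻∪▷⁺⇒≻) ,
  (λ _ _ → ⟶R⇒≻) , lhs≻condition
  where open UnravelingSimulation ar rule
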